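{- Let $q$ be a power of an odd prime, $r=2$, $k=q+1$, $0\le a,b\le q-2$, and $\Delta(a,b):=(1+\omega^{ak}-\omega^{bk})^2-4\omega^{ak}\in\mathbb{F}_q$. Then $(a,b)_{q-1}=1$ if $\Delta(a,b)=0$; $(a,b)_{q-1}=0$ if $\Delta(a,b)\neq0$ is a square in $\mathbb{F}_q$; and $(a,b)_{q-1}=2$ if $\Delta(a,b)$ is a nonsquare in $\mathbb{F}_q$.
   Context: Fix a generator $\omega$ of $\mathbb{F}_{q^2}^\times$; let $e=q-1$, $C_a:=\omega^a\langle\omega^e\rangle$ and $(a,b)_e:=\#\{x\in C_a\mid x+1\in C_b\}$. -}

module Defs where

open import Level using (Level; _⊔_; suc)
open import Data.Nat as ℕ using (ℕ; zero)
open import Data.Fin using (Fin)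
open import Data.Product using (Σ; ∃; _×_)
open import Relation.Nullary using (¬_; Dec)
open import Relation.Binary.PropositionalEquality using (_≡_)
open import Algebra.Bundles using (CommutativeRing)

record FiniteField (c ℓ : Level) : Set (Level.suc (c ⊔ ℓ)) where
  field
    commRing : CommutativeRing c ℓ
  open CommutativeRing commRing public
  field
    _≟_      : (x y : Carrier) → Dec (x ≈ y)
    1≉0      : ¬ (1# ≈ 0#)
    inverse  : (x : Carrier) → ¬ (x ≈ 0#) → ∃ λ y → x * y ≈ 1#
    size     : ℕ
    enum     : Fin size → Carrier
    enum-inj : (i j : Fin size) → enum i ≈ enum j → i ≡ j
    enum-sur : (x : Carrier) → ∃ λ i → enum i ≈ x

module FF {c ℓ : Level} (F : FiniteField c ℓ) where
  open FiniteField F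

  infixr 8 _^_
  _^_ : Carrier → ℕ → Carrier
  x ^ zero = 1#
  x ^ ℕ.suc n = x * (x ^ n)

  4# : Carrier
  4# = 1# + 1# + 1# + 1#

  IsGenerator : Carrier → Set (c ⊔ ℓ)
  IsGenerator ω = (x : Carrier) → ¬ (x ≈ 0#) → ∃ λ (i : ℕ) → x ≈ ω ^ i

  InClass : (ω : Carrier) (e a : ℕ) → Carrier → Set ℓ
  InClass ω e a x = ∃ λ (j : ℕ) → x ≈ (ω ^ a) * ((ω ^ e) ^ j)

  HasCard : (Carrier → Set ℓ) → ℕ → Set (c ⊔ ℓ)
  HasCard P m = Σ (Fin m → Carrier) λ f →
    ((i j : Fin m) → f i ≈ f j → i ≡ j) ×
    ((i : Fin m) → P (f i)) ×
    ((x : Carrier) → P x → ∃ λ i → f i ≈ x)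

  -- cyclotomic number (a,b)_e = #{ x ∈ C_a | x + 1 ∈ C_b };  CycNum ω e a b m  means (a,b)_e = m
  CycNum : (ω : Carrier) (e a b m : ℕ) → Set (c ⊔ ℓ)
  CycNum ω e a b m = HasCard (λ x → InClass ω e a x × InClass ω e b (x + 1#)) m

  -- the subfield F_q = { y | y^q = y } (q = p^n with field size q^2)
  InSubfield : ℕ → Carrier → Set ℓ
  InSubfield q y = y ^ q ≈ y

  IsSquareIn : ℕ → Carrier → Set (c ⊔ ℓ)
  IsSquareIn q x = ∃ λ y → InSubfield q y × (y * y ≈ x)

-- x ↦ x ^ q is the Frobenius automorphism σ of F = 𝔽_{q²} over 𝔽_q: it is additive because the
-- characteristic p divides the middle binomial coefficients of (x + y) ^ p (and p · 1 ≈ 0 because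
-- translation by 1 permutes F), and σ ∘ σ is the identity because ω has order q² − 1 (by counting).
-- The norm Nm x = x · σ x sends ω ^ m to ω ^ (m (q + 1)), so x ∈ C_a iff Nm x = α := ω ^ (a (q + 1)).
-- Since Nm (x + 1) = Nm x + (x + σ x) + 1, the conditions x ∈ C_a and x + 1 ∈ C_b say x · σ x = α and
-- x + σ x = − s, i.e. x and σ x are the two roots of χ = X² + s X + α, counted with multiplicity.
-- With D x = 2 x + s, χ x = 0 iff (D x)² = Δ.  If Δ = 0, the double root − s / 2 is the only solution.
-- If Δ is a nonzero square in 𝔽_q, both roots lie in 𝔽_q and are distinct, so neither is a solution.
-- Otherwise Δ, being fixed by σ, is a square δ² in F but not in 𝔽_q; the roots (± δ − s) / 2 are
-- swapped by σ and both are solutions.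

module Submission where

open import Defs
open import Level using (Level)
open import Algebra.Bundles using (CommutativeRing)
import Algebra.Solver.Ring.AlmostCommutativeRing as ACR
open import Data.Nat as ℕ using (ℕ; zero; suc; _≤_; _<_; _!; z<s; s<s)
import Data.Nat.Properties as ℕ
open import Data.Nat.Combinatorics using (_C_; nCk≡n!/k![n-k]!; k![n∸k]!∣n!; nCn≡1)
open import Data.Nat.Divisibility using (_∣_; divides; ∣⇒≤; ∣1⇒≡1; m∣m*n; m%n≡0⇒n∣m; ∣-trans; *-cancelˡ-∣; *-cancelʳ-∣)
open import Data.Nat.DivMod using (_%_; _/_; m/n*n≡m; m≡m%n+[m/n]*n; m%n<n)
open import Data.Nat.Primality using (Prime; euclidsLemma; prime⇒nonTrivial; prime⇒nonZero; prime⇒irreducible; prime[2])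
open import Data.Nat.Tactic.RingSolver using (solve-∀)
open import Data.Integer as ℤ using (ℤ; +_; -[1+_]; _⊖_; ∣_∣; sign; _◃_)
import Data.Integer.Properties as ℤ
open import Data.Sign as Sign using (Sign)
open import Data.Fin as Fin using (Fin; toℕ; fromℕ; fromℕ<; inject₁)
import Data.Fin.Properties as Fin
open import Data.Fin.Permutation using (Permutation; permutation)
open import Data.Maybe using (Maybe; just; nothing)
open import Data.Product using (_×_; _,_; ∃; proj₁; proj₂)
open import Data.Sum as Sum using (_⊎_; inj₁; inj₂; [_,_]′; reduce)
open import Data.Empty using (⊥-elim)
open import Relation.Nullary using (¬_; yes; no)
open import Relation.Binary.PropositionalEquality as ≡ using (_≡_; _≢_)

-- The library's ring solvers take coefficients in ℕ (no subtraction) or in the ring itself (where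
-- numerals such as 1# + 1# are not normalised), so we instantiate the solver with integer coefficients.
module ℤ-CoefficientSolver {c ℓ} (R : CommutativeRing c ℓ) where
  open CommutativeRing R
  open import Algebra.Properties.Ring ring using (-0#≈0#; -‿distribˡ-*; -‿distribʳ-*; -‿involutive; -‿+-comm)
  open import Algebra.Properties.Semiring.Mult.TCOptimised semiring using (1+×; ×-homo-+; ×1-homo-*) renaming (_×_ to _·_)
  open import Relation.Binary.Reasoning.Setoid setoid

  private
    ⟦_⟧ : ℤ → Carrier
    ⟦ + n ⟧ = n · 1#
    ⟦ -[1+ n ] ⟧ = - (suc n · 1#)

    signed : Sign → Carrier → Carrier
    signed Sign.+ x = x
    signed Sign.- x = - x

    signed-cong : ∀ s {x y} → x ≈ y → signed s x ≈ signed s y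
    signed-cong Sign.+ x≈y = x≈y
    signed-cong Sign.- x≈y = -‿cong x≈y

    ⟦◃⟧ : ∀ s n → ⟦ s ◃ n ⟧ ≈ signed s (n · 1#)
    ⟦◃⟧ Sign.+ zero = refl
    ⟦◃⟧ Sign.- zero = sym -0#≈0#
    ⟦◃⟧ Sign.+ (suc n) = refl
    ⟦◃⟧ Sign.- (suc n) = refl

    ⟦⟧-sign : ∀ i → ⟦ i ⟧ ≈ signed (sign i) (∣ i ∣ · 1#)
    ⟦⟧-sign (+ n) = refl
    ⟦⟧-sign -[1+ n ] = refl

    signed-* : ∀ s t x y → signed (s Sign.* t) (x * y) ≈ signed s x * signed t y
    signed-* Sign.+ Sign.+ x y = refl
    signed-* Sign.+ Sign.- x y = -‿distribʳ-* x y
    signed-* Sign.- Sign.+ x y = -‿distribˡ-* x y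
    signed-* Sign.- Sign.- x y = begin
      x * y         ≈⟨ -‿involutive (x * y) ⟨
      - - (x * y)   ≈⟨ -‿cong (-‿distribˡ-* x y) ⟩
      - (- x * y)   ≈⟨ -‿distribʳ-* (- x) y ⟩
      - x * - y     ∎

    [1+x]-[1+y] : ∀ x y → (1# + x) - (1# + y) ≈ x - y
    [1+x]-[1+y] x y = begin
      (1# + x) + - (1# + y)      ≈⟨ +-congˡ (-‿+-comm 1# y) ⟨
      (1# + x) + (- 1# + - y)    ≈⟨ +-congʳ (+-comm 1# x) ⟩
      (x + 1#) + (- 1# + - y)    ≈⟨ +-assoc x 1# _ ⟩
      x + (1# + (- 1# + - y))    ≈⟨ +-congˡ (+-assoc 1# (- 1#) (- y)) ⟨
      x + ((1# - 1#) + - y)      ≈⟨ +-congˡ (+-congʳ (-‿inverseʳ 1#)) ⟩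
      x + (0# + - y)             ≈⟨ +-congˡ (+-identityˡ (- y)) ⟩
      x - y                      ∎

    ⟦⊖⟧ : ∀ m n → ⟦ m ⊖ n ⟧ ≈ m · 1# - n · 1#
    ⟦⊖⟧ m zero = begin
      m · 1#          ≈⟨ +-identityʳ _ ⟨
      m · 1# + 0#     ≈⟨ +-congˡ -0#≈0# ⟨
      m · 1# - 0#     ∎
    ⟦⊖⟧ zero (suc n) = sym (+-identityˡ _)
    ⟦⊖⟧ (suc m) (suc n) = begin
      ⟦ suc m ⊖ suc n ⟧                ≡⟨ ≡.cong ⟦_⟧ (ℤ.[1+m]⊖[1+n]≡m⊖n m n) ⟩
      ⟦ m ⊖ n ⟧                        ≈⟨ ⟦⊖⟧ m n ⟩
      m · 1# - n · 1#                  ≈⟨ [1+x]-[1+y] _ _ ⟨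
      (1# + m · 1#) - (1# + n · 1#)    ≈⟨ +-cong (1+× m 1#) (-‿cong (1+× n 1#)) ⟨
      suc m · 1# - suc n · 1#          ∎

    +-homo : ∀ i j → ⟦ i ℤ.+ j ⟧ ≈ ⟦ i ⟧ + ⟦ j ⟧
    +-homo (+ m) (+ n) = ×-homo-+ 1# m n
    +-homo (+ m) -[1+ n ] = ⟦⊖⟧ m (suc n)
    +-homo -[1+ m ] (+ n) = trans (⟦⊖⟧ n (suc m)) (+-comm _ _)
    +-homo -[1+ m ] -[1+ n ] = begin
      - (suc (suc (m ℕ.+ n)) · 1#)         ≡⟨ ≡.cong (λ k → - (suc k · 1#)) (ℕ.+-suc m n) ⟨
      - ((suc m ℕ.+ suc n) · 1#)           ≈⟨ -‿cong (×-homo-+ 1# (suc m) (suc n)) ⟩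
      - (suc m · 1# + suc n · 1#)          ≈⟨ -‿+-comm _ _ ⟨
      - (suc m · 1#) + - (suc n · 1#)      ∎

    *-homo : ∀ i j → ⟦ i ℤ.* j ⟧ ≈ ⟦ i ⟧ * ⟦ j ⟧
    *-homo i j = begin
      ⟦ (sign i Sign.* sign j) ◃ (∣ i ∣ ℕ.* ∣ j ∣) ⟧               ≈⟨ ⟦◃⟧ _ (∣ i ∣ ℕ.* ∣ j ∣) ⟩
      signed (sign i Sign.* sign j) ((∣ i ∣ ℕ.* ∣ j ∣) · 1#)       ≈⟨ signed-cong (sign i Sign.* sign j) (×1-homo-* ∣ i ∣ ∣ j ∣) ⟩
      signed (sign i Sign.* sign j) (∣ i ∣ · 1# * ∣ j ∣ · 1#)      ≈⟨ signed-* (sign i) (sign j) _ _ ⟩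
      signed (sign i) (∣ i ∣ · 1#) * signed (sign j) (∣ j ∣ · 1#)  ≈⟨ *-cong (⟦⟧-sign i) (⟦⟧-sign j) ⟨
      ⟦ i ⟧ * ⟦ j ⟧                                               ∎

    -‿homo : ∀ i → ⟦ ℤ.- i ⟧ ≈ - ⟦ i ⟧
    -‿homo (+ zero) = sym -0#≈0#
    -‿homo (+ suc n) = refl
    -‿homo -[1+ n ] = sym (-‿involutive _)

    homomorphism : ACR._-Raw-AlmostCommutative⟶_ ℤ.+-*-rawRing (ACR.fromCommutativeRing R)
    homomorphism = record
      { ⟦_⟧ = ⟦_⟧ ; +-homo = +-homo ; *-homo = *-homo ; -‿homo = -‿homo
      ; 0-homo = refl ; 1-homo = refl }

    decide-≈ : ∀ i j → Maybe (⟦ i ⟧ ≈ ⟦ j ⟧)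
    decide-≈ i j with i ℤ.≟ j
    ... | yes ≡.refl = just refl
    ... | no _ = nothing

  open import Algebra.Solver.Ring ℤ.+-*-rawRing (ACR.fromCommutativeRing R) homomorphism decide-≈ public
    using (solve; _:=_; _:+_; _:*_; _:-_; :-_; con)

prime⇒1<p : ∀ {p} → Prime p → 1 < p
prime⇒1<p {p} p-prime = ℕ.nonTrivial⇒n>1 p {{prime⇒nonTrivial p-prime}}

prime∤m! : ∀ {p m} → Prime p → m < p → ¬ p ∣ m !
prime∤m! {m = zero} p-prime _ p∣1 = ℕ.<⇒≢ (prime⇒1<p p-prime) (≡.sym (∣1⇒≡1 p∣1))
prime∤m! {m = suc m} p-prime m<p p∣m! with euclidsLemma (suc m) (m !) p-prime p∣m!
... | inj₁ p∣1+m = ℕ.<⇒≱ m<p (∣⇒≤ p∣1+m)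
... | inj₂ p∣m! = prime∤m! p-prime (ℕ.<-trans (ℕ.n<1+n m) m<p) p∣m!

n∣n! : ∀ n → .{{ℕ.NonZero n}} → n ∣ n !
n∣n! (suc n) = m∣m*n (n !)

nCk*[k!*[n∸k]!]≡n! : ∀ {n k} → k ℕ.≤ n → (n C k) ℕ.* (k ! ℕ.* (n ℕ.∸ k) !) ≡ n !
nCk*[k!*[n∸k]!]≡n! {n} {k} k≤n = begin
  (n C k) ℕ.* (k ! ℕ.* (n ℕ.∸ k) !)                         ≡⟨ ≡.cong (ℕ._* (k ! ℕ.* (n ℕ.∸ k) !)) (nCk≡n!/k![n-k]! k≤n) ⟩
  (n ! ℕ./ (k ! ℕ.* (n ℕ.∸ k) !)) ℕ.* (k ! ℕ.* (n ℕ.∸ k) !) ≡⟨ m/n*n≡m (k![n∸k]!∣n! k≤n) ⟩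
  n !                                                       ∎
  where
  open ≡.≡-Reasoning
  instance _ = k ℕ.!* (n ℕ.∸ k) !≢0

prime∣pCk : ∀ {p k} → Prime p → 0 < k → k < p → p ∣ p C k
prime∣pCk {p} {k} p-prime 0<k k<p
  with euclidsLemma (p C k) _ p-prime
         (≡.subst (p ∣_) (≡.sym (nCk*[k!*[n∸k]!]≡n! (ℕ.<⇒≤ k<p))) (n∣n! p {{prime⇒nonZero p-prime}}))
... | inj₁ p∣pCk = p∣pCk
... | inj₂ p∣k!*[p∸k]! with euclidsLemma (k !) ((p ℕ.∸ k) !) p-prime p∣k!*[p∸k]!
...   | inj₁ p∣k! = ⊥-elim (prime∤m! p-prime k<p p∣k!)
...   | inj₂ p∣[p∸k]! = ⊥-elim (prime∤m! p-prime (ℕ.∸-monoʳ-< 0<k (ℕ.<⇒≤ k<p)) p∣[p∸k]!)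

¬2∣m⇒m≡1+[m/2]*2 : ∀ m → ¬ 2 ∣ m → m ≡ suc (m / 2 ℕ.* 2)
¬2∣m⇒m≡1+[m/2]*2 m ¬2∣m with m % 2 in m%2≡r | m%n<n m 2
... | zero | _ = ⊥-elim (¬2∣m (m%n≡0⇒n∣m m 2 m%2≡r))
... | suc zero | _ = ≡.trans (m≡m%n+[m/n]*n m 2) (≡.cong (ℕ._+ m / 2 ℕ.* 2) m%2≡r)
... | suc (suc _) | s<s (s<s ())

odd-prime⇒¬2∣p : ∀ {p} → Prime p → p ≢ 2 → ¬ 2 ∣ p
odd-prime⇒¬2∣p p-prime p≢2 2∣p with prime⇒irreducible p-prime 2∣p
... | inj₁ ()
... | inj₂ 2≡p = p≢2 (≡.sym 2≡p)

¬2∣m⇒¬2∣m^n : ∀ {m} → ¬ 2 ∣ m → ∀ n → ¬ 2 ∣ m ℕ.^ n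
¬2∣m⇒¬2∣m^n _ zero 2∣1 with ∣1⇒≡1 2∣1
... | ()
¬2∣m⇒¬2∣m^n {m} ¬2∣m (suc n) 2∣m^[1+n] with euclidsLemma m (m ℕ.^ n) prime[2] 2∣m^[1+n]
... | inj₁ 2∣m = ¬2∣m 2∣m
... | inj₂ 2∣m^n = ¬2∣m⇒¬2∣m^n ¬2∣m n 2∣m^n

module Frobenius {c ℓ} (R : CommutativeRing c ℓ) where
  open CommutativeRing R
  open import Algebra.Properties.Semiring.Mult semiring using (×-congʳ; ×-assocˡ; ×-assoc-*) renaming (_×_ to _·_)
  open import Algebra.Properties.Semiring.Exp semiring using (_^_; ^-assocʳ; ^-congˡ)
  open import Algebra.Properties.Monoid.Sum +-monoid using (sum; sum-cong-≋; sum-init-last; sum-replicate-zero)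
  open import Algebra.Properties.CommutativeSemiring.Binomial commutativeSemiring using (theorem; binomialTerm)
  open import Relation.Binary.Reasoning.Setoid setoid

  ·-zeroʳ : ∀ n → n · 0# ≈ 0#
  ·-zeroʳ zero = refl
  ·-zeroʳ (suc n) = trans (+-identityˡ _) (·-zeroʳ n)

  ^-distrib-+-if-middle-binomials≈0 : ∀ n → .{{ℕ.NonZero n}} → (∀ {k} z → 0 < k → k < n → (n C k) · z ≈ 0#) →
                                      ∀ x y → (x + y) ^ n ≈ x ^ n + y ^ n
  ^-distrib-+-if-middle-binomials≈0 (suc n) middle≈0 x y = begin
    (x + y) ^ suc n                                                   ≈⟨ theorem (suc n) x y ⟩
    term Fin.zero + sum (λ i → term (Fin.suc i))                      ≈⟨ +-congˡ (sum-init-last (λ i → term (Fin.suc i))) ⟩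
    term Fin.zero + (sum (λ i → term (Fin.suc (inject₁ i))) + term (Fin.suc (fromℕ n)))
      ≈⟨ +-congˡ (+-congʳ (trans (sum-cong-≋ inner≈0) (sum-replicate-zero n))) ⟩
    term Fin.zero + (0# + term (Fin.suc (fromℕ n)))                   ≈⟨ +-congˡ (+-identityˡ _) ⟩
    term Fin.zero + term (Fin.suc (fromℕ n))                          ≈⟨ +-cong first last ⟩
    y ^ suc n + x ^ suc n                                             ≈⟨ +-comm _ _ ⟩
    x ^ suc n + y ^ suc n                                             ∎
    where
    term = binomialTerm x y (suc n)
    inner≈0 : ∀ i → term (Fin.suc (inject₁ i)) ≈ 0#
    inner≈0 i = middle≈0 _ z<s (s<s (≡.subst (_< n) (≡.sym (Fin.toℕ-inject₁ i)) (Fin.toℕ<n i)))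
    first : term Fin.zero ≈ y ^ suc n
    first = trans (+-identityʳ _) (*-identityˡ _)
    last : term (Fin.suc (fromℕ n)) ≈ x ^ suc n
    last = begin
      term (Fin.suc (fromℕ n))                                     ≡⟨ ≡.cong (λ k → (suc n C suc k) · (x ^ suc k * y ^ (n ℕ.∸ k))) (Fin.toℕ-fromℕ n) ⟩
      (suc n C suc n) · (x ^ suc n * y ^ (n ℕ.∸ n))                ≡⟨ ≡.cong₂ (λ c m → c · (x ^ suc n * y ^ m)) (nCn≡1 (suc n)) (ℕ.n∸n≡0 n) ⟩
      1 · (x ^ suc n * 1#)                                         ≈⟨ +-identityʳ _ ⟩
      x ^ suc n * 1#                                               ≈⟨ *-identityʳ _ ⟩
      x ^ suc n                                                    ∎

  module _ {p : ℕ} (p-prime : Prime p) (p·1≈0 : p · 1# ≈ 0#) where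

    p·x≈0 : ∀ x → p · x ≈ 0#
    p·x≈0 x = begin
      p · x           ≈⟨ ×-congʳ p (*-identityˡ x) ⟨
      p · (1# * x)    ≈⟨ ×-assoc-* p 1# x ⟨
      (p · 1#) * x    ≈⟨ *-congʳ p·1≈0 ⟩
      0# * x          ≈⟨ zeroˡ x ⟩
      0#              ∎

    pCk·x≈0 : ∀ {k} x → 0 < k → k < p → (p C k) · x ≈ 0#
    pCk·x≈0 {k} x 0<k k<p with prime∣pCk p-prime 0<k k<p
    ... | divides m pCk≡m*p = begin
      (p C k) · x      ≡⟨ ≡.cong (_· x) pCk≡m*p ⟩
      (m ℕ.* p) · x    ≈⟨ ×-assocˡ x m p ⟨
      m · (p · x)      ≈⟨ ×-congʳ m (p·x≈0 x) ⟩
      m · 0#           ≈⟨ ·-zeroʳ m ⟩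
      0#               ∎

    ^p-distrib-+ : ∀ x y → (x + y) ^ p ≈ x ^ p + y ^ p
    ^p-distrib-+ = ^-distrib-+-if-middle-binomials≈0 p {{prime⇒nonZero p-prime}} pCk·x≈0

    ^p^m-distrib-+ : ∀ m x y → (x + y) ^ (p ℕ.^ m) ≈ x ^ (p ℕ.^ m) + y ^ (p ℕ.^ m)
    ^p^m-distrib-+ zero x y = distribʳ 1# x y
    ^p^m-distrib-+ (suc m) x y = begin
      (x + y) ^ (p ℕ.* p ℕ.^ m)                    ≈⟨ ^-assocʳ (x + y) p (p ℕ.^ m) ⟨
      ((x + y) ^ p) ^ (p ℕ.^ m)                    ≈⟨ ^-congˡ (p ℕ.^ m) (^p-distrib-+ x y) ⟩
      (x ^ p + y ^ p) ^ (p ℕ.^ m)                  ≈⟨ ^p^m-distrib-+ m (x ^ p) (y ^ p) ⟩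
      (x ^ p) ^ (p ℕ.^ m) + (y ^ p) ^ (p ℕ.^ m)    ≈⟨ +-cong (^-assocʳ x p (p ℕ.^ m)) (^-assocʳ y p (p ℕ.^ m)) ⟩
      x ^ (p ℕ.* p ℕ.^ m) + y ^ (p ℕ.* p ℕ.^ m)    ∎

module FiniteFieldProperties {c ℓ} (F : FiniteField c ℓ) where
  open FiniteField F
  open FF F
  open import Algebra.Properties.Ring ring using (+-cancelˡ; x∙y⁻¹≈ε⇒x≈y; +-inverseʳ-unique)
  open import Algebra.Properties.Semiring.Mult semiring using (×1-homo-*) renaming (_×_ to _·_)
  open import Algebra.Properties.CommutativeMonoid.Sum +-commutativeMonoid using (sum; sum-permute; sum-cong-≋; ∑-distrib-+; sum-replicate)
  open import Algebra.Properties.CommutativeSemiring.Exp commutativeSemiring as Exp using () renaming (_^_ to _^ᴱ_)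
  open import Relation.Binary.Reasoning.Setoid setoid
  open ℤ-CoefficientSolver commRing

  *-integral : ∀ {x y} → x * y ≈ 0# → x ≈ 0# ⊎ y ≈ 0#
  *-integral {x} {y} x*y≈0 with x ≟ 0#
  ... | yes x≈0 = inj₁ x≈0
  ... | no x≉0 = inj₂ (begin
    y                ≈⟨ *-identityˡ y ⟨
    1# * y           ≈⟨ *-congʳ x*x⁻¹≈1 ⟨
    (x * x⁻¹) * y    ≈⟨ solve 3 (λ x x⁻¹ y → (x :* x⁻¹) :* y := x⁻¹ :* (x :* y)) refl x x⁻¹ y ⟩
    x⁻¹ * (x * y)    ≈⟨ *-congˡ x*y≈0 ⟩
    x⁻¹ * 0#         ≈⟨ zeroʳ x⁻¹ ⟩
    0#               ∎)
    where
    x⁻¹ = proj₁ (inverse x x≉0)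
    x*x⁻¹≈1 = proj₂ (inverse x x≉0)

  *-nonzero : ∀ {x y} → x ≉ 0# → y ≉ 0# → x * y ≉ 0#
  *-nonzero x≉0 y≉0 x*y≈0 = [ x≉0 , y≉0 ]′ (*-integral x*y≈0)

  *-cancelˡ-nonzero : ∀ {z x y} → z ≉ 0# → z * x ≈ z * y → x ≈ y
  *-cancelˡ-nonzero {z} {x} {y} z≉0 z*x≈z*y =
    [ (λ z≈0 → ⊥-elim (z≉0 z≈0)) , x∙y⁻¹≈ε⇒x≈y x y ]′ (*-integral z*[x-y]≈0)
    where
    z*[x-y]≈0 : z * (x - y) ≈ 0#
    z*[x-y]≈0 = begin
      z * (x - y)        ≈⟨ solve 3 (λ z x y → z :* (x :- y) := z :* x :- z :* y) refl z x y ⟩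
      z * x - z * y      ≈⟨ +-congʳ z*x≈z*y ⟩
      z * y - z * y      ≈⟨ -‿inverseʳ (z * y) ⟩
      0#                 ∎

  square-roots : ∀ {u v} → u * u ≈ v * v → u ≈ v ⊎ u ≈ - v
  square-roots {u} {v} u²≈v² =
    Sum.map (x∙y⁻¹≈ε⇒x≈y u v) (λ u+v≈0 → +-inverseʳ-unique v u (trans (+-comm v u) u+v≈0)) (*-integral [u-v]*[u+v]≈0)
    where
    [u-v]*[u+v]≈0 : (u - v) * (u + v) ≈ 0#
    [u-v]*[u+v]≈0 = begin
      (u - v) * (u + v)   ≈⟨ solve 2 (λ u v → (u :- v) :* (u :+ v) := u :* u :- v :* v) refl u v ⟩
      u * u - v * v       ≈⟨ +-congʳ u²≈v² ⟩
      v * v - v * v       ≈⟨ -‿inverseʳ (v * v) ⟩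
      0#                  ∎

  ^≈^ᴱ : ∀ x n → x ^ n ≈ x ^ᴱ n
  ^≈^ᴱ x zero = refl
  ^≈^ᴱ x (suc n) = *-congˡ (^≈^ᴱ x n)

  ^-congˡ : ∀ n {x y} → x ≈ y → x ^ n ≈ y ^ n
  ^-congˡ zero x≈y = refl
  ^-congˡ (suc n) x≈y = *-cong x≈y (^-congˡ n x≈y)

  ^-homo-* : ∀ x m n → x ^ (m ℕ.+ n) ≈ x ^ m * x ^ n
  ^-homo-* x m n = begin
    x ^ (m ℕ.+ n)          ≈⟨ ^≈^ᴱ x (m ℕ.+ n) ⟩
    x ^ᴱ (m ℕ.+ n)      ≈⟨ Exp.^-homo-* x m n ⟩
    x ^ᴱ m * x ^ᴱ n  ≈⟨ *-cong (^≈^ᴱ x m) (^≈^ᴱ x n) ⟨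
    x ^ m * x ^ n          ∎

  ^-assocʳ : ∀ x m n → (x ^ m) ^ n ≈ x ^ (m ℕ.* n)
  ^-assocʳ x m n = begin
    (x ^ m) ^ n            ≈⟨ ^≈^ᴱ (x ^ m) n ⟩
    (x ^ m) ^ᴱ n        ≈⟨ Exp.^-congˡ n (^≈^ᴱ x m) ⟩
    (x ^ᴱ m) ^ᴱ n    ≈⟨ Exp.^-assocʳ x m n ⟩
    x ^ᴱ (m ℕ.* n)      ≈⟨ ^≈^ᴱ x (m ℕ.* n) ⟨
    x ^ (m ℕ.* n)          ∎

  ^-distrib-* : ∀ x y n → (x * y) ^ n ≈ x ^ n * y ^ n
  ^-distrib-* x y n = begin
    (x * y) ^ n              ≈⟨ ^≈^ᴱ (x * y) n ⟩
    (x * y) ^ᴱ n          ≈⟨ Exp.^-distrib-* x y n ⟩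
    x ^ᴱ n * y ^ᴱ n    ≈⟨ *-cong (^≈^ᴱ x n) (^≈^ᴱ y n) ⟨
    x ^ n * y ^ n            ∎

  x^a*[x^b]^j≈x^[a+b*j] : ∀ x a b j → x ^ a * (x ^ b) ^ j ≈ x ^ (a ℕ.+ b ℕ.* j)
  x^a*[x^b]^j≈x^[a+b*j] x a b j = trans (*-congˡ (^-assocʳ x b j)) (sym (^-homo-* x a (b ℕ.* j)))

  1^n≈1 : ∀ n → 1# ^ n ≈ 1#
  1^n≈1 zero = refl
  1^n≈1 (suc n) = trans (*-identityˡ _) (1^n≈1 n)

  ^-nonzero : ∀ {x} n → x ≉ 0# → x ^ n ≉ 0#
  ^-nonzero zero x≉0 = 1≉0
  ^-nonzero (suc n) x≉0 = *-nonzero x≉0 (^-nonzero n x≉0)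

  ^≈0⇒≈0 : ∀ {x} n → x ^ n ≈ 0# → x ≈ 0#
  ^≈0⇒≈0 {x} n x^n≈0 with x ≟ 0#
  ... | yes x≈0 = x≈0
  ... | no x≉0 = ⊥-elim (^-nonzero n x≉0 x^n≈0)

  ^-mod : ∀ {x} t .{{_ : ℕ.NonZero t}} → x ^ t ≈ 1# → ∀ m → x ^ m ≈ x ^ (m % t)
  ^-mod {x} t x^t≈1 m = begin
    x ^ m                              ≡⟨ ≡.cong (x ^_) (≡.trans (m≡m%n+[m/n]*n m t) (≡.cong (m % t ℕ.+_) (ℕ.*-comm (m / t) t))) ⟩
    x ^ (m % t ℕ.+ t ℕ.* (m / t))      ≈⟨ ^-homo-* x (m % t) _ ⟩
    x ^ (m % t) * x ^ (t ℕ.* (m / t))  ≈⟨ *-congˡ (^-assocʳ x t (m / t)) ⟨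
    x ^ (m % t) * (x ^ t) ^ (m / t)    ≈⟨ *-congˡ (trans (^-congˡ (m / t) x^t≈1) (1^n≈1 (m / t))) ⟩
    x ^ (m % t) * 1#                   ≈⟨ *-identityʳ _ ⟩
    x ^ (m % t)                        ∎

  index : Carrier → Fin size
  index x = proj₁ (enum-sur x)

  enum∘index : ∀ x → enum (index x) ≈ x
  enum∘index x = proj₂ (enum-sur x)

  index-injective : ∀ {x y} → index x ≡ index y → x ≈ y
  index-injective {x} {y} eq = begin
    x                ≈⟨ enum∘index x ⟨
    enum (index x)   ≡⟨ ≡.cong enum eq ⟩
    enum (index y)   ≈⟨ enum∘index y ⟩
    y                ∎

  size·1≈0 : size · 1# ≈ 0#
  size·1≈0 = +-cancelˡ Σx (size · 1#) 0# (begin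
    Σx + size · 1#                 ≈⟨ +-congˡ (sum-replicate size) ⟨
    Σx + sum {size} (λ _ → 1#)     ≈⟨ ∑-distrib-+ enum (λ _ → 1#) ⟨
    sum (λ i → enum i + 1#)        ≈⟨ sum-cong-≋ (λ i → enum∘index (enum i + 1#)) ⟨
    sum (λ i → enum (shift 1# i))  ≈⟨ sum-permute enum translation ⟨
    Σx                             ≈⟨ +-identityʳ Σx ⟨
    Σx + 0#                        ∎)
    where
    Σx = sum enum
    shift : Carrier → Fin size → Fin size
    shift a i = index (enum i + a)
    shift-inverse : ∀ {a b} → b + a ≈ 0# → ∀ i → shift a (shift b i) ≡ i
    shift-inverse {a} {b} b+a≈0 i = enum-inj _ _ (begin
      enum (shift a (shift b i))   ≈⟨ enum∘index _ ⟩
      enum (shift b i) + a         ≈⟨ +-congʳ (enum∘index _) ⟩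
      (enum i + b) + a             ≈⟨ +-assoc _ _ _ ⟩
      enum i + (b + a)             ≈⟨ +-congˡ b+a≈0 ⟩
      enum i + 0#                  ≈⟨ +-identityʳ _ ⟩
      enum i                       ∎)
    translation : Permutation size size
    translation = permutation (shift 1#) (shift (- 1#)) (shift-inverse (-‿inverseˡ 1#)) (shift-inverse (-‿inverseʳ 1#))

  [m^n]·1≈[m·1]^n : ∀ m n → (m ℕ.^ n) · 1# ≈ (m · 1#) ^ n
  [m^n]·1≈[m·1]^n m zero = +-identityʳ 1#
  [m^n]·1≈[m·1]^n m (suc n) = trans (×1-homo-* m (m ℕ.^ n)) (*-congˡ ([m^n]·1≈[m·1]^n m n))

  module _ {P Q : Carrier → Set ℓ} where

    hasCard-⇔ : (∀ {x} → P x → Q x) → (∀ {x} → Q x → P x) → ∀ {m} → HasCard P m → HasCard Q m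
    hasCard-⇔ P⇒Q Q⇒P (f , f-injective , f-in , f-onto) =
      f , f-injective , (λ i → P⇒Q (f-in i)) , (λ x Qx → f-onto x (Q⇒P Qx))

  module _ {P : Carrier → Set ℓ} where

    hasCard-0 : (∀ {x} → ¬ P x) → HasCard P 0
    hasCard-0 ¬P = (λ ()) , (λ ()) , (λ ()) , (λ x Px → ⊥-elim (¬P Px))

    hasCard-1 : ∀ {x₀} → P x₀ → (∀ {x} → P x → x ≈ x₀) → HasCard P 1
    hasCard-1 {x₀} Px₀ unique =
      (λ _ → x₀) , (λ { Fin.zero Fin.zero _ → ≡.refl }) , (λ _ → Px₀) , (λ x Px → Fin.zero , sym (unique Px))

    hasCard-2 : ∀ {x₁ x₂} → x₁ ≉ x₂ → P x₁ → P x₂ → (∀ {x} → P x → x ≈ x₁ ⊎ x ≈ x₂) → HasCard P 2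
    hasCard-2 {x₁} {x₂} x₁≉x₂ Px₁ Px₂ exhaustive = f , f-injective , f-in , f-onto
      where
      f : Fin 2 → Carrier
      f Fin.zero = x₁
      f (Fin.suc Fin.zero) = x₂
      f-injective : ∀ i j → f i ≈ f j → i ≡ j
      f-injective Fin.zero Fin.zero _ = ≡.refl
      f-injective Fin.zero (Fin.suc Fin.zero) x₁≈x₂ = ⊥-elim (x₁≉x₂ x₁≈x₂)
      f-injective (Fin.suc Fin.zero) Fin.zero x₂≈x₁ = ⊥-elim (x₁≉x₂ (sym x₂≈x₁))
      f-injective (Fin.suc Fin.zero) (Fin.suc Fin.zero) _ = ≡.refl
      f-in : ∀ i → P (f i)
      f-in Fin.zero = Px₁
      f-in (Fin.suc Fin.zero) = Px₂
      f-onto : ∀ x → P x → ∃ λ i → f i ≈ x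
      f-onto x Px with exhaustive Px
      ... | inj₁ x≈x₁ = Fin.zero , sym x≈x₁
      ... | inj₂ x≈x₂ = Fin.suc Fin.zero , sym x≈x₂

  generator-nonzero : ∀ {ω x} → IsGenerator ω → x ≉ 0# → x ≉ 1# → ω ≉ 0#
  generator-nonzero {ω} {x} generator x≉0 x≉1 ω≈0 with generator x x≉0
  ... | zero , x≈1 = x≉1 x≈1
  ... | suc i , x≈ω^[1+i] = x≉0 (trans x≈ω^[1+i] (trans (*-congʳ ω≈0) (zeroˡ _)))

  module Generator {ω : Carrier} (generator : IsGenerator ω) (ω≉0 : ω ≉ 0#)
                   {N : ℕ} .{{_ : ℕ.NonZero N}} (size≡1+N : size ≡ suc N) where

    log : ∀ x → x ≉ 0# → ℕ
    log x x≉0 = proj₁ (generator x x≉0)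

    ≈ω^log : ∀ x (x≉0 : x ≉ 0#) → x ≈ ω ^ log x x≉0
    ≈ω^log x x≉0 = proj₂ (generator x x≉0)

    ω^i≈ω^j⇒ω^[j∸i]≈1 : ∀ {i j} → i ≤ j → ω ^ i ≈ ω ^ j → ω ^ (j ℕ.∸ i) ≈ 1#
    ω^i≈ω^j⇒ω^[j∸i]≈1 {i} {j} i≤j ω^i≈ω^j = sym (*-cancelˡ-nonzero (^-nonzero i ω≉0) (begin
      ω ^ i * 1#                ≈⟨ *-identityʳ _ ⟩
      ω ^ i                     ≈⟨ ω^i≈ω^j ⟩
      ω ^ j                     ≡⟨ ≡.cong (ω ^_) (ℕ.m+[n∸m]≡n i≤j) ⟨
      ω ^ (i ℕ.+ (j ℕ.∸ i))     ≈⟨ ^-homo-* ω i (j ℕ.∸ i) ⟩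
      ω ^ i * ω ^ (j ℕ.∸ i)     ∎))

    -- Every nonzero x is ω ^ (log x % t), so F embeds into Fin (suc t).
    period⇒N≤ : ∀ {t} → 0 < t → ω ^ t ≈ 1# → N ≤ t
    period⇒N≤ {t} 0<t ω^t≈1 =
      ℕ.≤-pred (≡.subst (_≤ suc t) size≡1+N (Fin.injective⇒≤ (λ {i} {j} eq → enum-inj i j (code-injective eq))))
      where
      instance _ = ℕ.>-nonZero 0<t
      code : Carrier → Fin (suc t)
      code x with x ≟ 0#
      ... | yes _ = Fin.zero
      ... | no x≉0 = Fin.suc (fromℕ< (m%n<n (log x x≉0) t))
      ≈ω^[log%t] : ∀ x (x≉0 : x ≉ 0#) → x ≈ ω ^ (log x x≉0 % t)
      ≈ω^[log%t] x x≉0 = trans (≈ω^log x x≉0) (^-mod t ω^t≈1 (log x x≉0))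
      code-injective : ∀ {x y} → code x ≡ code y → x ≈ y
      code-injective {x} {y} eq with x ≟ 0# | y ≟ 0#
      ... | yes x≈0 | yes y≈0 = trans x≈0 (sym y≈0)
      ... | no x≉0 | no y≉0 = begin
        x                        ≈⟨ ≈ω^[log%t] x x≉0 ⟩
        ω ^ (log x x≉0 % t)      ≡⟨ ≡.cong (ω ^_) (Fin.fromℕ<-injective _ _ _ _ (Fin.suc-injective eq)) ⟩
        ω ^ (log y y≉0 % t)      ≈⟨ ≈ω^[log%t] y y≉0 ⟨
        y                        ∎

    zero-or-power : Fin (suc size) → Fin size
    zero-or-power Fin.zero = index 0#
    zero-or-power (Fin.suc k) = index (ω ^ toℕ k)

    -- Two of 0, ω ^ 0, …, ω ^ N coincide; this yields a period t ≤ N, and period⇒N≤ forces t = N.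
    ω^N≈1 : ω ^ N ≈ 1#
    ω^N≈1 with Fin.pigeonhole (ℕ.n<1+n size) zero-or-power
    ... | Fin.zero , Fin.suc l , _ , eq = ⊥-elim (^-nonzero (toℕ l) ω≉0 (sym (index-injective eq)))
    ... | Fin.suc k , Fin.suc l , s<s k<l , eq = ≡.subst (λ t → ω ^ t ≈ 1#) t≡N ω^t≈1
      where
      t = toℕ l ℕ.∸ toℕ k
      ω^t≈1 = ω^i≈ω^j⇒ω^[j∸i]≈1 (ℕ.<⇒≤ k<l) (index-injective eq)
      t≡N : t ≡ N
      t≡N = ℕ.≤-antisym
        (ℕ.≤-trans (ℕ.m∸n≤m (toℕ l) (toℕ k)) (ℕ.≤-pred (≡.subst (toℕ l <_) size≡1+N (Fin.toℕ<n l))))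
        (period⇒N≤ (ℕ.m<n⇒0<n∸m k<l) ω^t≈1)

    ω^[m+N*j]≈ω^m : ∀ m j → ω ^ (m ℕ.+ N ℕ.* j) ≈ ω ^ m
    ω^[m+N*j]≈ω^m m j = begin
      ω ^ (m ℕ.+ N ℕ.* j)    ≈⟨ x^a*[x^b]^j≈x^[a+b*j] ω m N j ⟨
      ω ^ m * (ω ^ N) ^ j    ≈⟨ *-congˡ (trans (^-congˡ j ω^N≈1) (1^n≈1 j)) ⟩
      ω ^ m * 1#             ≈⟨ *-identityʳ _ ⟩
      ω ^ m                  ∎

    ω^m≈1⇒N∣m : ∀ m → ω ^ m ≈ 1# → N ∣ m
    ω^m≈1⇒N∣m m ω^m≈1 with m % N in m%N≡r | m%n<n m N
    ... | zero | _ = m%n≡0⇒n∣m m N m%N≡r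
    ... | suc r | 1+r<N = ⊥-elim (ℕ.<⇒≱ 1+r<N (period⇒N≤ z<s (begin
      ω ^ suc r      ≡⟨ ≡.cong (ω ^_) m%N≡r ⟨
      ω ^ (m % N)    ≈⟨ ^-mod N ω^N≈1 m ⟨
      ω ^ m          ≈⟨ ω^m≈1 ⟩
      1#             ∎)))

    ω^i≈ω^j⇒N∣j∸i : ∀ {i j} → i ≤ j → ω ^ i ≈ ω ^ j → N ∣ j ℕ.∸ i
    ω^i≈ω^j⇒N∣j∸i i≤j ω^i≈ω^j = ω^m≈1⇒N∣m _ (ω^i≈ω^j⇒ω^[j∸i]≈1 i≤j ω^i≈ω^j)

    x^N≈1 : ∀ {x} → x ≉ 0# → x ^ N ≈ 1#
    x^N≈1 {x} x≉0 = begin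
      x ^ N                        ≈⟨ ^-congˡ N (≈ω^log x x≉0) ⟩
      (ω ^ log x x≉0) ^ N          ≈⟨ ^-assocʳ ω (log x x≉0) N ⟩
      ω ^ (log x x≉0 ℕ.* N)        ≡⟨ ≡.cong (ω ^_) (ℕ.*-comm (log x x≉0) N) ⟩
      ω ^ (N ℕ.* log x x≉0)        ≈⟨ ^-assocʳ ω N (log x x≉0) ⟨
      (ω ^ N) ^ log x x≉0          ≈⟨ ^-congˡ (log x x≉0) ω^N≈1 ⟩
      1# ^ log x x≉0               ≈⟨ 1^n≈1 (log x x≉0) ⟩
      1#                           ∎

module QuadraticExtension {c ℓ} (F : FiniteField c ℓ) {p n q : ℕ} (p-prime : Prime p) (p≢2 : p ≢ 2)
  (q≡p^[1+n] : q ≡ p ℕ.^ suc n) (size≡q*q : FiniteField.size F ≡ q ℕ.* q)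
  {ω : FiniteField.Carrier F} (generator : FF.IsGenerator F ω) where
  open FiniteField F
  open FF F
  open FiniteFieldProperties F
  open import Algebra.Properties.Ring ring using (+-cancelˡ; +-cancelʳ; +-inverseʳ-unique; x∙y⁻¹≈ε⇒x≈y)
  open import Algebra.Properties.Semiring.Mult semiring using (×1-homo-*) renaming (_×_ to _·_)
  open import Algebra.Properties.Semiring.Exp semiring using () renaming (_^_ to _^ᴱ_)
  open import Relation.Binary.Reasoning.Setoid setoid
  open ℤ-CoefficientSolver commRing

  e k N : ℕ
  e = q ℕ.∸ 1
  k = q ℕ.+ 1
  N = e ℕ.* k

  instance
    q-nonzero : ℕ.NonZero q
    q-nonzero = ≡.subst ℕ.NonZero (≡.sym q≡p^[1+n]) (ℕ.m^n≢0 p (suc n) {{prime⇒nonZero p-prime}})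

    e-nonzero : ℕ.NonZero e
    e-nonzero = ℕ.>-nonZero (ℕ.m<n⇒0<n∸m 1<q)
      where
      1<q : 1 < q
      1<q = ≡.subst (1 <_) (≡.sym q≡p^[1+n])
              (ℕ.≤-trans (prime⇒1<p p-prime) (ℕ.m≤m*n p (p ℕ.^ n) {{ℕ.m^n≢0 p n {{prime⇒nonZero p-prime}}}}))

    k-nonzero : ℕ.NonZero k
    k-nonzero = ≡.subst ℕ.NonZero (ℕ.+-comm 1 q) _

    N-nonzero : ℕ.NonZero N
    N-nonzero = ℕ.m*n≢0 e k

  q≡1+e : q ≡ suc e
  q≡1+e = ≡.sym (ℕ.suc-pred q)

  size≡1+N : size ≡ suc N
  size≡1+N = ≡.trans size≡q*q (≡.subst (λ r → r ℕ.* r ≡ suc (e ℕ.* (r ℕ.+ 1))) (≡.sym q≡1+e) (lemma e))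
    where
    lemma : ∀ m → suc m ℕ.* suc m ≡ suc (m ℕ.* (suc m ℕ.+ 1))
    lemma = solve-∀

  ¬2∣q : ¬ 2 ∣ q
  ¬2∣q 2∣q = ¬2∣m⇒¬2∣m^n (odd-prime⇒¬2∣p p-prime p≢2) (suc n) (≡.subst (2 ∣_) q≡p^[1+n] 2∣q)

  2∣k : 2 ∣ k
  2∣k = divides (q ℕ./ 2 ℕ.+ 1) (≡.trans (≡.cong (ℕ._+ 1) (¬2∣m⇒m≡1+[m/2]*2 q ¬2∣q)) (lemma (q ℕ./ 2)))
    where
    lemma : ∀ u → suc (u ℕ.* 2) ℕ.+ 1 ≡ (u ℕ.+ 1) ℕ.* 2
    lemma = solve-∀

  two : Carrier
  two = 1# + 1#

  p·1≈0 : p · 1# ≈ 0#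
  p·1≈0 = ^≈0⇒≈0 (suc n) (begin
    (p · 1#) ^ suc n        ≈⟨ [m^n]·1≈[m·1]^n p (suc n) ⟨
    (p ℕ.^ suc n) · 1#      ≡⟨ ≡.cong (_· 1#) q≡p^[1+n] ⟨
    q · 1#                  ≈⟨ q·1≈0 ⟩
    0#                      ∎)
    where
    q·1≈0 : q · 1# ≈ 0#
    q·1≈0 = reduce (*-integral (begin
      (q · 1#) * (q · 1#)    ≈⟨ ×1-homo-* q q ⟨
      (q ℕ.* q) · 1#         ≡⟨ ≡.cong (_· 1#) size≡q*q ⟨
      size · 1#              ≈⟨ size·1≈0 ⟩
      0#                     ∎))

  two≉0 : two ≉ 0#
  two≉0 two≈0 = 1≉0 (begin
    1#                        ≈⟨ +-identityʳ 1# ⟨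
    1# + 0#                   ≈⟨ +-congˡ (zeroʳ (u · 1#)) ⟨
    1# + (u · 1#) * 0#        ≈⟨ +-congˡ (*-congˡ two≈0) ⟨
    1# + (u · 1#) * two       ≈⟨ +-congˡ (*-congˡ (+-congˡ (+-identityʳ 1#))) ⟨
    1# + (u · 1#) * (2 · 1#)  ≈⟨ +-congˡ (×1-homo-* u 2) ⟨
    1# + (u ℕ.* 2) · 1#       ≡⟨ ≡.cong (_· 1#) (¬2∣m⇒m≡1+[m/2]*2 p (odd-prime⇒¬2∣p p-prime p≢2)) ⟨
    p · 1#                    ≈⟨ p·1≈0 ⟩
    0#                        ∎)
    where u = p ℕ./ 2

  two≉1 : two ≉ 1#
  two≉1 two≈1 = 1≉0 (+-cancelˡ 1# 1# 0# (trans two≈1 (sym (+-identityʳ 1#))))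

  ω≉0 : ω ≉ 0#
  ω≉0 = generator-nonzero generator two≉0 two≉1

  open Generator generator ω≉0 size≡1+N

  σ : Carrier → Carrier
  σ x = x ^ q

  σ-cong : ∀ {x y} → x ≈ y → σ x ≈ σ y
  σ-cong = ^-congˡ q

  σ-+ : ∀ x y → σ (x + y) ≈ σ x + σ y
  σ-+ x y = ≡.subst (λ r → (x + y) ^ r ≈ x ^ r + y ^ r) (≡.sym q≡p^[1+n]) (begin
    (x + y) ^ p^[1+n]                   ≈⟨ ^≈^ᴱ (x + y) p^[1+n] ⟩
    (x + y) ^ᴱ p^[1+n]                  ≈⟨ Frobenius.^p^m-distrib-+ commRing p-prime p·1≈0 (suc n) x y ⟩
    x ^ᴱ p^[1+n] + y ^ᴱ p^[1+n]         ≈⟨ +-cong (^≈^ᴱ x p^[1+n]) (^≈^ᴱ y p^[1+n]) ⟨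
    x ^ p^[1+n] + y ^ p^[1+n]           ∎)
    where p^[1+n] = p ℕ.^ suc n

  σ-* : ∀ x y → σ (x * y) ≈ σ x * σ y
  σ-* x y = ^-distrib-* x y q

  σ-1 : σ 1# ≈ 1#
  σ-1 = 1^n≈1 q

  σ-0 : σ 0# ≈ 0#
  σ-0 = ≡.subst (λ r → 0# ^ r ≈ 0#) (≡.sym q≡1+e) (zeroˡ _)

  σ-neg : ∀ x → σ (- x) ≈ - σ x
  σ-neg x = +-inverseʳ-unique (σ x) (σ (- x)) (begin
    σ x + σ (- x)    ≈⟨ σ-+ x (- x) ⟨
    σ (x - x)        ≈⟨ σ-cong (-‿inverseʳ x) ⟩
    σ 0#             ≈⟨ σ-0 ⟩
    0#               ∎)

  σ-involutive : ∀ x → σ (σ x) ≈ x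
  σ-involutive x = begin
    (x ^ q) ^ q       ≈⟨ ^-assocʳ x q q ⟩
    x ^ (q ℕ.* q)     ≡⟨ ≡.cong (x ^_) (≡.trans (≡.sym size≡q*q) size≡1+N) ⟩
    x * x ^ N         ≈⟨ x*x^N≈x ⟩
    x                 ∎
    where
    x*x^N≈x : x * x ^ N ≈ x
    x*x^N≈x with x ≟ 0#
    ... | yes x≈0 = trans (*-congʳ x≈0) (trans (zeroˡ _) (sym x≈0))
    ... | no x≉0 = trans (*-congˡ (x^N≈1 x≉0)) (*-identityʳ x)

  Nm : Carrier → Carrier
  Nm x = x * σ x

  Nm-cong : ∀ {x y} → x ≈ y → Nm x ≈ Nm y
  Nm-cong x≈y = *-cong x≈y (σ-cong x≈y)

  Nm-ω^ : ∀ m → Nm (ω ^ m) ≈ ω ^ (m ℕ.* k)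
  Nm-ω^ m = begin
    ω ^ m * (ω ^ m) ^ q      ≈⟨ *-congˡ (^-assocʳ ω m q) ⟩
    ω ^ m * ω ^ (m ℕ.* q)    ≈⟨ ^-homo-* ω m (m ℕ.* q) ⟨
    ω ^ (m ℕ.+ m ℕ.* q)      ≡⟨ ≡.cong (ω ^_) (≡.trans (≡.sym (ℕ.*-suc m q)) (≡.cong (m ℕ.*_) (ℕ.+-comm 1 q))) ⟩
    ω ^ (m ℕ.* k)            ∎

  σ-Nm : ∀ x → σ (Nm x) ≈ Nm x
  σ-Nm x = trans (σ-* x (σ x)) (trans (*-congˡ (σ-involutive x)) (*-comm (σ x) x))

  σ-ω^[m*k] : ∀ m → σ (ω ^ (m ℕ.* k)) ≈ ω ^ (m ℕ.* k)
  σ-ω^[m*k] m = trans (σ-cong (sym (Nm-ω^ m))) (trans (σ-Nm (ω ^ m)) (Nm-ω^ m))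

  Nm-+1 : ∀ x → Nm (x + 1#) ≈ Nm x + (x + σ x) + 1#
  Nm-+1 x = begin
    (x + 1#) * σ (x + 1#)         ≈⟨ *-congˡ (trans (σ-+ x 1#) (+-congˡ σ-1)) ⟩
    (x + 1#) * (σ x + 1#)         ≈⟨ solve 2 (λ x y → (x :+ con (+ 1)) :* (y :+ con (+ 1)) := x :* y :+ (x :+ y) :+ con (+ 1)) refl x (σ x) ⟩
    x * σ x + (x + σ x) + 1#      ∎

  InClass⇒Nm≈ : ∀ a {x} → InClass ω e a x → Nm x ≈ ω ^ (a ℕ.* k)
  InClass⇒Nm≈ a {x} (j , x≈ω^a*[ω^e]^j) = begin
    Nm x                            ≈⟨ Nm-cong (trans x≈ω^a*[ω^e]^j (x^a*[x^b]^j≈x^[a+b*j] ω a e j)) ⟩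
    Nm (ω ^ (a ℕ.+ e ℕ.* j))        ≈⟨ Nm-ω^ (a ℕ.+ e ℕ.* j) ⟩
    ω ^ ((a ℕ.+ e ℕ.* j) ℕ.* k)     ≡⟨ ≡.cong (ω ^_) (lemma a e j k) ⟩
    ω ^ (a ℕ.* k ℕ.+ N ℕ.* j)       ≈⟨ ω^[m+N*j]≈ω^m (a ℕ.* k) j ⟩
    ω ^ (a ℕ.* k)                   ∎
    where
    lemma : ∀ a e j k → (a ℕ.+ e ℕ.* j) ℕ.* k ≡ a ℕ.* k ℕ.+ e ℕ.* k ℕ.* j
    lemma = solve-∀

  Nm≈⇒InClass : ∀ a {x} → Nm x ≈ ω ^ (a ℕ.* k) → InClass ω e a x
  Nm≈⇒InClass a {x} Nm[x]≈ω^[a*k] = j , (begin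
    x                              ≈⟨ x≈ω^i ⟩
    ω ^ i                          ≡⟨ ≡.cong (ω ^_) i≡a+e*j ⟩
    ω ^ (a ℕ.+ e ℕ.* j)            ≈⟨ x^a*[x^b]^j≈x^[a+b*j] ω a e j ⟨
    ω ^ a * (ω ^ e) ^ j            ∎)
    where
    x≉0 : x ≉ 0#
    x≉0 x≈0 = ^-nonzero (a ℕ.* k) ω≉0 (trans (sym Nm[x]≈ω^[a*k]) (trans (*-congʳ x≈0) (zeroˡ _)))
    -- Shifting the logarithm by a multiple of N makes it at least a without changing ω ^ i.
    i = log x x≉0 ℕ.+ N ℕ.* a
    x≈ω^i : x ≈ ω ^ i
    x≈ω^i = trans (≈ω^log x x≉0) (sym (ω^[m+N*j]≈ω^m (log x x≉0) a))
    a≤i : a ≤ i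
    a≤i = ℕ.≤-trans (ℕ.m≤n*m a N) (ℕ.m≤n+m (N ℕ.* a) (log x x≉0))
    N∣[i∸a]*k : N ∣ (i ℕ.∸ a) ℕ.* k
    N∣[i∸a]*k = ≡.subst (N ∣_) (≡.sym (ℕ.*-distribʳ-∸ k i a))
      (ω^i≈ω^j⇒N∣j∸i (ℕ.*-monoˡ-≤ k a≤i) (trans (sym Nm[x]≈ω^[a*k]) (trans (Nm-cong x≈ω^i) (Nm-ω^ i))))
    e∣i∸a : e ∣ i ℕ.∸ a
    e∣i∸a = *-cancelʳ-∣ k N∣[i∸a]*k
    j = _∣_.quotient e∣i∸a
    i≡a+e*j : i ≡ a ℕ.+ e ℕ.* j
    i≡a+e*j = ≡.trans (≡.sym (ℕ.m+[n∸m]≡n a≤i)) (≡.cong (a ℕ.+_) (≡.trans (_∣_.equality e∣i∸a) (ℕ.*-comm j e)))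

  -- σ z ≈ z forces (q − 1) (q + 1) ∣ (q − 1) (log z), and q + 1 is even.
  fixed⇒square : ∀ {z} → z ≉ 0# → σ z ≈ z → ∃ λ δ → δ * δ ≈ z
  fixed⇒square {z} z≉0 σz≈z = ω ^ h , (begin
    ω ^ h * ω ^ h       ≈⟨ ^-homo-* ω h h ⟨
    ω ^ (h ℕ.+ h)       ≡⟨ ≡.cong (ω ^_) h+h≡i ⟩
    ω ^ i               ≈⟨ ≈ω^log z z≉0 ⟨
    z                   ∎)
    where
    i = log z z≉0
    ω^i≈ω^[i*q] : ω ^ i ≈ ω ^ (i ℕ.* q)
    ω^i≈ω^[i*q] = begin
      ω ^ i          ≈⟨ ≈ω^log z z≉0 ⟨
      z              ≈⟨ σz≈z ⟨
      σ z            ≈⟨ σ-cong (≈ω^log z z≉0) ⟩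
      (ω ^ i) ^ q    ≈⟨ ^-assocʳ ω i q ⟩
      ω ^ (i ℕ.* q)  ∎
    N∣e*i : N ∣ e ℕ.* i
    N∣e*i = ≡.subst (N ∣_) (≡.trans (≡.cong (i ℕ.* q ℕ.∸_) (≡.sym (ℕ.*-identityʳ i)))
                     (≡.trans (≡.sym (ℕ.*-distribˡ-∸ i q 1)) (ℕ.*-comm i e)))
              (ω^i≈ω^j⇒N∣j∸i (ℕ.m≤m*n i q) ω^i≈ω^[i*q])
    2∣i : 2 ∣ i
    2∣i = ∣-trans 2∣k (*-cancelˡ-∣ e N∣e*i)
    h = _∣_.quotient 2∣i
    h+h≡i : h ℕ.+ h ≡ i
    h+h≡i = ≡.trans (≡.cong (h ℕ.+_) (≡.sym (ℕ.+-identityʳ h))) (≡.trans (ℕ.*-comm 2 h) (≡.sym (_∣_.equality 2∣i)))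

  σ-− : ∀ x y → σ (x - y) ≈ σ x - σ y
  σ-− x y = trans (σ-+ x (- y)) (+-congˡ (σ-neg y))

  σ-two : σ two ≈ two
  σ-two = trans (σ-+ 1# 1#) (+-cong σ-1 σ-1)

  σ-4 : σ 4# ≈ 4#
  σ-4 = trans (σ-+ _ 1#) (+-cong (trans (σ-+ two 1#) (+-cong σ-two σ-1)) σ-1)

  two*x≈x+x : ∀ x → two * x ≈ x + x
  two*x≈x+x x = trans (distribʳ x 1# 1#) (+-cong (*-identityˡ x) (*-identityˡ x))

  two*x≈0⇒x≈0 : ∀ {x} → two * x ≈ 0# → x ≈ 0#
  two*x≈0⇒x≈0 two*x≈0 with *-integral two*x≈0
  ... | inj₁ two≈0 = ⊥-elim (two≉0 two≈0)
  ... | inj₂ x≈0 = x≈0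

  module NormEquation {α β : Carrier} (σα≈α : σ α ≈ α) (σβ≈β : σ β ≈ β) where

    s Δ : Carrier
    s = (1# + α) - β
    Δ = (s * s) - (4# * α)

    Solution : Carrier → Set ℓ
    Solution x = Nm x ≈ α × Nm (x + 1#) ≈ β

    χ : Carrier → Carrier
    χ x = x * x + s * x + α

    D : Carrier → Carrier
    D x = two * x + s

    σ-s : σ s ≈ s
    σ-s = trans (σ-− (1# + α) β) (+-cong (trans (σ-+ 1# α) (+-cong σ-1 σα≈α)) (-‿cong σβ≈β))

    σ-Δ : σ Δ ≈ Δ
    σ-Δ = trans (σ-− (s * s) (4# * α)) (+-cong (trans (σ-* s s) (*-cong σ-s σ-s)) (-‿cong (trans (σ-* 4# α) (*-cong σ-4 σα≈α))))

    σ-χ : ∀ x → σ (χ x) ≈ χ (σ x)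
    σ-χ x = trans (σ-+ _ α) (+-cong (trans (σ-+ (x * x) (s * x)) (+-cong (σ-* x x) (trans (σ-* s x) (*-congʳ σ-s)))) σα≈α)

    σ-D : ∀ x → σ (D x) ≈ D (σ x)
    σ-D x = trans (σ-+ (two * x) s) (+-cong (trans (σ-* two x) (*-congʳ σ-two)) σ-s)

    D-injective : ∀ {x y} → D x ≈ D y → x ≈ y
    D-injective Dx≈Dy = *-cancelˡ-nonzero two≉0 (+-cancelʳ s _ _ Dx≈Dy)

    Solution⇒x+σx+s≈0 : ∀ {x} → Solution x → x + σ x + s ≈ 0#
    Solution⇒x+σx+s≈0 {x} (Nm[x]≈α , Nm[x+1]≈β) = begin
      x + σ x + s
        ≈⟨ solve 4 (λ x y α β → x :+ y :+ ((con (+ 1) :+ α) :- β)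
                                := ((x :* y :+ (x :+ y) :+ con (+ 1)) :- β) :- (x :* y :- α)) refl x (σ x) α β ⟩
      ((Nm x + (x + σ x) + 1#) - β) - (Nm x - α)
        ≈⟨ +-cong (+-congʳ (sym (Nm-+1 x))) (-‿cong (+-congʳ Nm[x]≈α)) ⟩
      (Nm (x + 1#) - β) - (α - α)
        ≈⟨ +-cong (+-congʳ Nm[x+1]≈β) (-‿cong (-‿inverseʳ α)) ⟩
      (β - β) - 0#
        ≈⟨ solve 1 (λ β → (β :- β) :- con (+ 0) := con (+ 0)) refl β ⟩
      0#
        ∎

    4*χ≈D²-Δ : ∀ x → 4# * χ x ≈ D x * D x - Δ
    4*χ≈D²-Δ x = solve 3 (λ x s α → con (+ 4) :* (x :* x :+ s :* x :+ α)
                                   := (con (+ 2) :* x :+ s) :* (con (+ 2) :* x :+ s) :- (s :* s :- con (+ 4) :* α)) refl x s α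

    Solution⇒D²≈Δ : ∀ {x} → Solution x → D x * D x ≈ Δ
    Solution⇒D²≈Δ {x} sol@(Nm[x]≈α , _) = begin
      D x * D x
        ≈⟨ solve 4 (λ x y s α → (con (+ 2) :* x :+ s) :* (con (+ 2) :* x :+ s)
                                := (s :* s :- con (+ 4) :* α) :+ con (+ 4) :* x :* (x :+ y :+ s) :- con (+ 4) :* (x :* y :- α))
                   refl x (σ x) s α ⟩
      Δ + 4# * x * (x + σ x + s) - 4# * (Nm x - α)
        ≈⟨ +-cong (+-congˡ (*-congˡ (Solution⇒x+σx+s≈0 sol))) (-‿cong (*-congˡ (trans (+-congʳ Nm[x]≈α) (-‿inverseʳ α)))) ⟩
      Δ + 4# * x * 0# - 4# * 0#
        ≈⟨ solve 3 (λ Δ f x → Δ :+ f :* x :* con (+ 0) :- f :* con (+ 0) := Δ) refl Δ 4# x ⟩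
      Δ
        ∎

    D²≈Δ⇒χ≈0 : ∀ {x} → D x * D x ≈ Δ → χ x ≈ 0#
    D²≈Δ⇒χ≈0 {x} D²≈Δ = two*x≈0⇒x≈0 (two*x≈0⇒x≈0 (begin
      two * (two * χ x)     ≈⟨ solve 1 (λ y → con (+ 2) :* (con (+ 2) :* y) := con (+ 4) :* y) refl (χ x) ⟩
      4# * χ x              ≈⟨ 4*χ≈D²-Δ x ⟩
      D x * D x - Δ         ≈⟨ +-congʳ D²≈Δ ⟩
      Δ - Δ                 ≈⟨ -‿inverseʳ Δ ⟩
      0#                    ∎))

    χ≈0∧x+σx+s≈0⇒Solution : ∀ {x} → χ x ≈ 0# → x + σ x + s ≈ 0# → Solution x
    χ≈0∧x+σx+s≈0⇒Solution {x} χ[x]≈0 x+σx+s≈0 = Nm[x]≈α , Nm[x+1]≈β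
      where
      Nm[x]≈α : Nm x ≈ α
      Nm[x]≈α = begin
        x * σ x
          ≈⟨ solve 4 (λ x y s α → x :* y := x :* (x :+ y :+ s) :- (x :* x :+ s :* x :+ α) :+ α) refl x (σ x) s α ⟩
        x * (x + σ x + s) - χ x + α
          ≈⟨ +-congʳ (+-cong (*-congˡ x+σx+s≈0) (-‿cong χ[x]≈0)) ⟩
        x * 0# - 0# + α
          ≈⟨ solve 2 (λ x α → x :* con (+ 0) :- con (+ 0) :+ α := α) refl x α ⟩
        α
          ∎
      Nm[x+1]≈β : Nm (x + 1#) ≈ β
      Nm[x+1]≈β = begin
        Nm (x + 1#)
          ≈⟨ Nm-+1 x ⟩
        x * σ x + (x + σ x) + 1#
          ≈⟨ solve 4 (λ x y α β → x :* y :+ (x :+ y) :+ con (+ 1)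
                                  := (x :* y :- α) :+ (x :+ y :+ ((con (+ 1) :+ α) :- β)) :+ β) refl x (σ x) α β ⟩
        (Nm x - α) + (x + σ x + s) + β
          ≈⟨ +-congʳ (+-cong (trans (+-congʳ Nm[x]≈α) (-‿inverseʳ α)) x+σx+s≈0) ⟩
        0# + 0# + β
          ≈⟨ solve 1 (λ β → con (+ 0) :+ con (+ 0) :+ β := β) refl β ⟩
        β
          ∎

    χ≈0⇒[x-σx]*[x+σx+s]≈0 : ∀ {x} → χ x ≈ 0# → (x - σ x) * (x + σ x + s) ≈ 0#
    χ≈0⇒[x-σx]*[x+σx+s]≈0 {x} χ[x]≈0 = begin
      (x - σ x) * (x + σ x + s)
        ≈⟨ solve 4 (λ x y s α → (x :- y) :* (x :+ y :+ s) := (x :* x :+ s :* x :+ α) :- (y :* y :+ s :* y :+ α)) refl x (σ x) s α ⟩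
      χ x - χ (σ x)
        ≈⟨ +-cong χ[x]≈0 (-‿cong (trans (sym (σ-χ x)) (trans (σ-cong χ[x]≈0) σ-0))) ⟩
      0# - 0#
        ≈⟨ -‿inverseʳ 0# ⟩
      0#
        ∎

    -- x and σ x are then distinct roots of χ, so their sum is − s.
    D²≈Δ∧unfixed⇒Solution : ∀ {x} → D x * D x ≈ Δ → σ x ≉ x → Solution x
    D²≈Δ∧unfixed⇒Solution {x} D²≈Δ σx≉x =
      [ (λ x-σx≈0 → ⊥-elim (σx≉x (sym (x∙y⁻¹≈ε⇒x≈y x (σ x) x-σx≈0)))) , χ≈0∧x+σx+s≈0⇒Solution χ[x]≈0 ]′
        (*-integral (χ≈0⇒[x-σx]*[x+σx+s]≈0 χ[x]≈0))
      where χ[x]≈0 = D²≈Δ⇒χ≈0 D²≈Δ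

    D⁻¹ : Carrier → Carrier
    D⁻¹ u = (u - s) * proj₁ (inverse two two≉0)

    D∘D⁻¹ : ∀ u → D (D⁻¹ u) ≈ u
    D∘D⁻¹ u = begin
      two * ((u - s) * ½) + s     ≈⟨ solve 4 (λ t u s h → t :* ((u :- s) :* h) :+ s := (u :- s) :* (t :* h) :+ s) refl two u s ½ ⟩
      (u - s) * (two * ½) + s     ≈⟨ +-congʳ (*-congˡ (proj₂ (inverse two two≉0))) ⟩
      (u - s) * 1# + s            ≈⟨ solve 2 (λ u s → (u :- s) :* con (+ 1) :+ s := u) refl u s ⟩
      u                           ∎
      where ½ = proj₁ (inverse two two≉0)

    D≈u⇒≈D⁻¹u : ∀ {x u} → D x ≈ u → x ≈ D⁻¹ u
    D≈u⇒≈D⁻¹u {u = u} Dx≈u = D-injective (trans Dx≈u (sym (D∘D⁻¹ u)))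

    D+σD≈two*[x+σx+s] : ∀ x → D x + σ (D x) ≈ two * (x + σ x + s)
    D+σD≈two*[x+σx+s] x = begin
      D x + σ (D x)                      ≈⟨ +-congˡ (σ-D x) ⟩
      (two * x + s) + (two * σ x + s)    ≈⟨ solve 3 (λ x y s → (con (+ 2) :* x :+ s) :+ (con (+ 2) :* y :+ s)
                                                              := con (+ 2) :* (x :+ y :+ s)) refl x (σ x) s ⟩
      two * (x + σ x + s)                ∎

    count-Δ≈0 : Δ ≈ 0# → HasCard Solution 1
    count-Δ≈0 Δ≈0 = hasCard-1 (χ≈0∧x+σx+s≈0⇒Solution χ[x₀]≈0 x₀+σx₀+s≈0) unique
      where
      x₀ = D⁻¹ 0#
      D[x₀]≈0 = D∘D⁻¹ 0#
      χ[x₀]≈0 : χ x₀ ≈ 0#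
      χ[x₀]≈0 = D²≈Δ⇒χ≈0 (trans (*-congʳ D[x₀]≈0) (trans (zeroˡ _) (sym Δ≈0)))
      x₀+σx₀+s≈0 : x₀ + σ x₀ + s ≈ 0#
      x₀+σx₀+s≈0 = two*x≈0⇒x≈0 (begin
        two * (x₀ + σ x₀ + s)    ≈⟨ D+σD≈two*[x+σx+s] x₀ ⟨
        D x₀ + σ (D x₀)          ≈⟨ +-cong D[x₀]≈0 (trans (σ-cong D[x₀]≈0) σ-0) ⟩
        0# + 0#                  ≈⟨ +-identityʳ 0# ⟩
        0#                       ∎)
      unique : ∀ {x} → Solution x → x ≈ x₀
      unique sol = D≈u⇒≈D⁻¹u (reduce (*-integral (trans (Solution⇒D²≈Δ sol) Δ≈0)))

    count-Δ-square : Δ ≉ 0# → IsSquareIn q Δ → HasCard Solution 0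
    count-Δ-square Δ≉0 (y , σy≈y , y²≈Δ) = hasCard-0 λ sol → Δ≉0 (Δ≈0 sol)
      where
      Δ≈0 : ∀ {x} → Solution x → Δ ≈ 0#
      Δ≈0 {x} sol = trans (sym (Solution⇒D²≈Δ sol)) (trans (*-congʳ D[x]≈0) (zeroˡ _))
        where
        σ-fixes-D[x] : σ (D x) ≈ D x
        σ-fixes-D[x] = [ (λ Dx≈y → trans (σ-cong Dx≈y) (trans σy≈y (sym Dx≈y)))
                       , (λ Dx≈-y → trans (σ-cong Dx≈-y) (trans (σ-neg y) (trans (-‿cong σy≈y) (sym Dx≈-y))))
                       ]′ (square-roots (trans (Solution⇒D²≈Δ sol) (sym y²≈Δ)))
        D[x]≈0 : D x ≈ 0#
        D[x]≈0 = two*x≈0⇒x≈0 (begin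
          two * D x                 ≈⟨ two*x≈x+x (D x) ⟩
          D x + D x                 ≈⟨ +-congˡ σ-fixes-D[x] ⟨
          D x + σ (D x)             ≈⟨ D+σD≈two*[x+σx+s] x ⟩
          two * (x + σ x + s)       ≈⟨ *-congˡ (Solution⇒x+σx+s≈0 sol) ⟩
          two * 0#                  ≈⟨ zeroʳ two ⟩
          0#                        ∎)

    count-Δ-nonsquare : ¬ IsSquareIn q Δ → HasCard Solution 2
    count-Δ-nonsquare Δ-nonsquare = hasCard-2 x₁≉x₂ (solution δ δ²≈Δ) (solution (- δ) [-δ]²≈Δ) exhaustive
      where
      Δ≉0 : Δ ≉ 0#
      Δ≉0 Δ≈0 = Δ-nonsquare (0# , σ-0 , trans (zeroˡ 0#) (sym Δ≈0))
      δ = proj₁ (fixed⇒square Δ≉0 σ-Δ)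
      δ²≈Δ = proj₂ (fixed⇒square Δ≉0 σ-Δ)
      [-δ]²≈Δ : - δ * - δ ≈ Δ
      [-δ]²≈Δ = trans (solve 1 (λ u → (:- u) :* (:- u) := u :* u) refl δ) δ²≈Δ
      x₁ = D⁻¹ δ
      x₂ = D⁻¹ (- δ)
      solution : ∀ u → u * u ≈ Δ → Solution (D⁻¹ u)
      solution u u²≈Δ = D²≈Δ∧unfixed⇒Solution D²≈Δ
        (λ σx≈x → Δ-nonsquare (D (D⁻¹ u) , trans (σ-D (D⁻¹ u)) (+-congʳ (*-congˡ σx≈x)) , D²≈Δ))
        where D²≈Δ = trans (*-cong (D∘D⁻¹ u) (D∘D⁻¹ u)) u²≈Δ
      x₁≉x₂ : x₁ ≉ x₂
      x₁≉x₂ x₁≈x₂ = Δ≉0 (begin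
        Δ          ≈⟨ δ²≈Δ ⟨
        δ * δ      ≈⟨ *-congʳ δ≈0 ⟩
        0# * δ     ≈⟨ zeroˡ δ ⟩
        0#         ∎)
        where
        δ≈-δ : δ ≈ - δ
        δ≈-δ = trans (sym (D∘D⁻¹ δ)) (trans (+-congʳ (*-congˡ x₁≈x₂)) (D∘D⁻¹ (- δ)))
        δ≈0 : δ ≈ 0#
        δ≈0 = two*x≈0⇒x≈0 (trans (two*x≈x+x δ) (trans (+-congˡ δ≈-δ) (-‿inverseʳ δ)))
      exhaustive : ∀ {x} → Solution x → x ≈ x₁ ⊎ x ≈ x₂
      exhaustive sol = Sum.map D≈u⇒≈D⁻¹u D≈u⇒≈D⁻¹u (square-roots (trans (Solution⇒D²≈Δ sol) (sym δ²≈Δ)))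

  module CyclotomicNumber (a b : ℕ) where
    open NormEquation (σ-ω^[m*k] a) (σ-ω^[m*k] b) public

    Solution⇒CycNum : ∀ {m} → HasCard Solution m → CycNum ω e a b m
    Solution⇒CycNum = hasCard-⇔
      (λ (Nm[x]≈α , Nm[x+1]≈β) → Nm≈⇒InClass a Nm[x]≈α , Nm≈⇒InClass b Nm[x+1]≈β)
      (λ (x∈Cₐ , x+1∈C_b) → InClass⇒Nm≈ a x∈Cₐ , InClass⇒Nm≈ b x+1∈C_b)

proposition3p5 : ∀ {c ℓ : Level} (p n q : ℕ) → Prime p → p ≢ 2 → q ≡ p ℕ.^ suc n →
  (F : FiniteField c ℓ) → FiniteField.size F ≡ q ℕ.* q →
  let open FiniteField F
      open FF F
  in (ω : Carrier) → IsGenerator ω →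
     (a b : ℕ) → a ≤ q ℕ.∸ 2 → b ≤ q ℕ.∸ 2 →
     let e = q ℕ.∸ 1
         k = q ℕ.+ 1
         s = (1# + ω ^ (a ℕ.* k)) - ω ^ (b ℕ.* k)
         Δ = (s * s) - (4# * ω ^ (a ℕ.* k))
     in ((Δ ≈ 0# → CycNum ω e a b 1)
        × (¬ (Δ ≈ 0#) → IsSquareIn q Δ → CycNum ω e a b 0)
        × (¬ IsSquareIn q Δ → CycNum ω e a b 2))
-- The bounds on a and b only pick representatives of the classes; the count does not need them.
proposition3p5 p n q p-prime p≢2 q≡p^[1+n] F size≡q*q ω generator a b _ _ =
  (λ Δ≈0 → Solution⇒CycNum (count-Δ≈0 Δ≈0)) ,
  (λ Δ≉0 Δ-square → Solution⇒CycNum (count-Δ-square Δ≉0 Δ-square)) ,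
  (λ Δ-nonsquare → Solution⇒CycNum (count-Δ-nonsquare Δ-nonsquare))
  where
  open QuadraticExtension F {n = n} p-prime p≢2 q≡p^[1+n] size≡q*q generator
  open CyclotomicNumber a b
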